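{- Let $(F_r)_{r\in\mathbb{Z}}$ be the Fibonacci numbers and $(\mathcal{F}_r)_{r\in\mathbb{Z}}$ any generalized Fibonacci sequence. Then for all integers $r,s$ and every nonnegative integer $k$, \[ \sum_{j=0}^{k}(-1)^j\mathcal{F}_{s-1}^{\,k-j}\mathcal{F}_s^{\,j}\mathcal{F}_{r+s+j}=F_r\mathcal{F}_{s-1}^{\,k+1}-(-1)^{k+1}F_{r+k+1}\mathcal{F}_s^{\,k+1}. \]
   Context: The Fibonacci numbers $(F_r)_{r\in\mathbb{Z}}$ satisfy $F_0=0$, $F_1=1$ and $F_r=F_{r-1}+F_{r-2}$ for all $r\in\mathbb{Z}$. A generalized Fibonacci sequence is any sequence $(\mathcal{F}_r)_{r\in\mathbb{Z}}$ of complex numbers with $\mathcal{F}_r=\mathcal{F}_{r-1}+\mathcal{F}_{r-2}$ for all $r\in\mathbb{Z}$. The convention $0^0=1$ is used. -}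

module Defs where

open import Level using (Level)
open import Data.Nat using (ℕ; zero; suc)
open import Data.Integer using (ℤ; +_; -[1+_]) renaming (_+_ to _+ℤ_; _-_ to _-ℤ_)
open import Algebra.Bundles using (CommutativeRing)

module _ {c ℓ : Level} (R : CommutativeRing c ℓ) where
  open CommutativeRing R hiding (zero)

  pow : Carrier → ℕ → Carrier
  pow x zero    = 1#
  pow x (suc n) = x * pow x n

  sumTo : ℕ → (ℕ → Carrier) → Carrier
  sumTo zero    f = f zero
  sumTo (suc k) f = sumTo k f + f (suc k)

  fibPos : ℕ → Carrier
  fibPos zero          = 0#
  fibPos (suc zero)    = 1#
  fibPos (suc (suc n)) = fibPos (suc n) + fibPos n

  -- Fibonacci numbers at negative indices: fibNeg n = F_{-(n+1)},
  -- obtained from the recurrence run backwards: F_{r-2} = F_r - F_{r-1}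
  fibNeg : ℕ → Carrier
  fibNeg zero          = 1#
  fibNeg (suc zero)    = 0# - 1#
  fibNeg (suc (suc n)) = fibNeg n - fibNeg (suc n)

  fib : ℤ → Carrier
  fib (+ n)    = fibPos n
  fib -[1+ n ] = fibNeg n

  IsGenFib : (ℤ → Carrier) → Set ℓ
  IsGenFib 𝓕 = ∀ (r : ℤ) → 𝓕 r ≈ 𝓕 (r -ℤ + 1) + 𝓕 (r -ℤ + 2)

-- Every generalized Fibonacci sequence satisfies the addition formula
-- 𝓕_{s+t} = F_t 𝓕_{s-1} + F_{t+1} 𝓕_s, since both sides solve the recurrence in t
-- and agree at t = 0, 1. Writing a = 𝓕_{s-1}, b = 𝓕_s and x_j = F_{r+j}, the j-th
-- summand becomes (-1)^j a^{k-j} b^j (x_j a + x_{j+1} b) = g_j - g_{j+1} with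
-- g_j = (-1)^j a^{k+1-j} b^j x_j, so the sum telescopes to g_0 - g_{k+1}.
module Submission where

open import Defs
open import Level using (Level)
open import Data.Nat using (ℕ; zero; suc; _∸_; _≤_; z≤n)
import Data.Nat.Properties as ℕₚ
open import Data.Integer using (ℤ; +_; -[1+_]) renaming (_+_ to _+ℤ_; _-_ to _-ℤ_)
import Data.Integer as ℤ
import Data.Integer.Properties as ℤₚ
open import Data.Integer.Tactic.RingSolver using (solve-∀)
open import Data.Product using (_×_; _,_; proj₁)
open import Relation.Binary.PropositionalEquality using (_≡_; cong)
open import Algebra.Bundles using (CommutativeRing)
import Algebra.Properties.Group as GroupProperties
import Algebra.Properties.Quasigroup as QuasigroupProperties
import Algebra.Properties.AbelianGroup as AbelianGroupProperties
import Algebra.Solver.Ring.NaturalCoefficients.Default as NaturalCoefficientsSolver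

-- ℤ.suc computes on both constructors, so each step below is definitional.
ℤ-induction : ∀ {p} (P : ℤ → Set p) → P (+ 0) →
              (∀ t → P t → P (ℤ.suc t)) → (∀ t → P (ℤ.suc t) → P t) →
              ∀ t → P t
ℤ-induction P base up down (+ zero)      = base
ℤ-induction P base up down (+ suc n)     = up (+ n) (ℤ-induction P base up down (+ n))
ℤ-induction P base up down -[1+ zero ]   = down -[1+ zero ] base
ℤ-induction P base up down -[1+ suc n ]  = down -[1+ suc n ] (ℤ-induction P base up down -[1+ n ])

1+[1+t]-1≡1+t : ∀ t → (+ 1 +ℤ (+ 1 +ℤ t)) -ℤ + 1 ≡ + 1 +ℤ t
1+[1+t]-1≡1+t = solve-∀

1+[1+t]-2≡t : ∀ t → (+ 1 +ℤ (+ 1 +ℤ t)) -ℤ + 2 ≡ t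
1+[1+t]-2≡t = solve-∀

[s+t]-n≡s+[t-n] : ∀ s t n → (s +ℤ t) -ℤ n ≡ s +ℤ (t -ℤ n)
[s+t]-n≡s+[t-n] = solve-∀

[s+1]-2≡s-1 : ∀ s → (s +ℤ + 1) -ℤ + 2 ≡ s -ℤ + 1
[s+1]-2≡s-1 = solve-∀

[s+1]-1≡s : ∀ s → (s +ℤ + 1) -ℤ + 1 ≡ s
[s+1]-1≡s = solve-∀

s+[r+j]≡r+s+j : ∀ r s j → s +ℤ (r +ℤ j) ≡ r +ℤ s +ℤ j
s+[r+j]≡r+s+j = solve-∀

1+[r+j]≡r+[1+j] : ∀ r j → + 1 +ℤ (r +ℤ j) ≡ r +ℤ (+ 1 +ℤ j)
1+[r+j]≡r+[1+j] = solve-∀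

module _ {c ℓ : Level} (R : CommutativeRing c ℓ) where
  open CommutativeRing R
  open import Relation.Binary.Reasoning.Setoid setoid
  open QuasigroupProperties (GroupProperties.quasigroup +-group) using (x≈z//y)
  open AbelianGroupProperties +-abelianGroup using (xyx⁻¹≈y)
  open NaturalCoefficientsSolver commutativeSemiring using (solve; _:=_; _:+_; _:*_; con)

  at : (u : ℤ → Carrier) {t t′ : ℤ} → t ≡ t′ → u t ≈ u t′
  at u eq = reflexive (cong u eq)

  isGenFib-fib : IsGenFib R (fib R)
  isGenFib-fib (+ zero)          = trans (sym (-‿inverseʳ 1#)) (+-congˡ (sym (+-identityˡ (- 1#))))
  isGenFib-fib (+ suc zero)      = sym (+-identityˡ 1#)
  isGenFib-fib (+ suc (suc n))   = refl
  isGenFib-fib -[1+ n ] = begin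
    fibNeg R n                                         ≈⟨ xyx⁻¹≈y y (fibNeg R n) ⟨
    y + fibNeg R n - y                                 ≈⟨ +-assoc y _ _ ⟩
    y + fibNeg R (suc (suc n))                         ≈⟨ +-cong (at (fib R) index₁) (at (fib R) index₂) ⟨
    fib R (-[1+ n ] -ℤ + 1) + fib R (-[1+ n ] -ℤ + 2)  ∎
    where
    y = fibNeg R (suc n)
    index₁ : -[1+ n ] -ℤ + 1 ≡ -[1+ suc n ]
    index₁ = cong (λ m → -[1+ suc m ]) (ℕₚ.+-identityʳ n)
    index₂ : -[1+ n ] -ℤ + 2 ≡ -[1+ suc (suc n) ]
    index₂ = cong (λ m → -[1+ suc m ]) (ℕₚ.+-comm n 1)

  isGenFib-step : ∀ {𝓕} → IsGenFib R 𝓕 → ∀ t → 𝓕 (ℤ.suc (ℤ.suc t)) ≈ 𝓕 (ℤ.suc t) + 𝓕 t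
  isGenFib-step {𝓕} isGenFib t =
    trans (isGenFib _) (+-cong (at 𝓕 (1+[1+t]-1≡1+t t)) (at 𝓕 (1+[1+t]-2≡t t)))

  isGenFib-stepBack : ∀ {𝓕} → IsGenFib R 𝓕 → ∀ t → 𝓕 t ≈ 𝓕 (ℤ.suc (ℤ.suc t)) - 𝓕 (ℤ.suc t)
  isGenFib-stepBack isGenFib t = x≈z//y _ _ _ (trans (+-comm _ _) (sym (isGenFib-step isGenFib t)))

  isGenFib-shift : ∀ {𝓕} → IsGenFib R 𝓕 → ∀ s → IsGenFib R (λ t → 𝓕 (s +ℤ t))
  isGenFib-shift {𝓕} isGenFib s t = trans (isGenFib _)
    (+-cong (at 𝓕 ([s+t]-n≡s+[t-n] s t (+ 1))) (at 𝓕 ([s+t]-n≡s+[t-n] s t (+ 2))))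

  isGenFib-linear : ∀ {𝓕 𝓖} → IsGenFib R 𝓕 → IsGenFib R 𝓖 →
                    ∀ a b → IsGenFib R (λ t → 𝓕 t * a + 𝓖 t * b)
  isGenFib-linear {𝓕} {𝓖} isGenFib𝓕 isGenFib𝓖 a b t = begin
    𝓕 t * a + 𝓖 t * b
      ≈⟨ +-cong (*-congʳ (isGenFib𝓕 t)) (*-congʳ (isGenFib𝓖 t)) ⟩
    (x + x′) * a + (y + y′) * b
      ≈⟨ solve 6 (λ a b x x′ y y′ → (x :+ x′) :* a :+ (y :+ y′) :* b
                                    := (x :* a :+ y :* b) :+ (x′ :* a :+ y′ :* b))
                 refl a b x x′ y y′ ⟩
    (x * a + y * b) + (x′ * a + y′ * b) ∎
    where
    x = 𝓕 (t -ℤ + 1); x′ = 𝓕 (t -ℤ + 2); y = 𝓖 (t -ℤ + 1); y′ = 𝓖 (t -ℤ + 2)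

  isGenFib-unique : ∀ {𝓕 𝓖} → IsGenFib R 𝓕 → IsGenFib R 𝓖 →
                    𝓕 (+ 0) ≈ 𝓖 (+ 0) → 𝓕 (+ 1) ≈ 𝓖 (+ 1) → ∀ t → 𝓕 t ≈ 𝓖 t
  isGenFib-unique {𝓕} {𝓖} isGenFib𝓕 isGenFib𝓖 eq₀ eq₁ t =
    proj₁ (ℤ-induction AgreeAt (eq₀ , eq₁) up down t)
    where
    AgreeAt : ℤ → Set ℓ
    AgreeAt t = 𝓕 t ≈ 𝓖 t × 𝓕 (ℤ.suc t) ≈ 𝓖 (ℤ.suc t)

    up : ∀ t → AgreeAt t → AgreeAt (ℤ.suc t)
    up t (eq , eq′) = eq′ , trans (isGenFib-step isGenFib𝓕 t)
      (trans (+-cong eq′ eq) (sym (isGenFib-step isGenFib𝓖 t)))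

    down : ∀ t → AgreeAt (ℤ.suc t) → AgreeAt t
    down t (eq′ , eq″) = trans (isGenFib-stepBack isGenFib𝓕 t)
      (trans (+-cong eq″ (-‿cong eq′)) (sym (isGenFib-stepBack isGenFib𝓖 t))) , eq′

  genFib-addition : ∀ {𝓕} → IsGenFib R 𝓕 →
                    ∀ s t → 𝓕 (s +ℤ t) ≈ fib R t * 𝓕 (s -ℤ + 1) + fib R (ℤ.suc t) * 𝓕 s
  genFib-addition {𝓕} isGenFib s = isGenFib-unique
    (isGenFib-shift isGenFib s)
    (isGenFib-linear isGenFib-fib (isGenFib-shift isGenFib-fib (+ 1)) a b)
    (begin
      𝓕 (s +ℤ + 0)         ≈⟨ at 𝓕 (ℤₚ.+-identityʳ s) ⟩
      b                    ≈⟨ solve 2 (λ a b → b := con 0 :* a :+ con 1 :* b) refl a b ⟩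
      0# * a + 1# * b      ∎)
    (begin
      𝓕 (s +ℤ + 1)         ≈⟨ isGenFib _ ⟩
      𝓕 ((s +ℤ + 1) -ℤ + 1) + 𝓕 ((s +ℤ + 1) -ℤ + 2)
                           ≈⟨ +-cong (at 𝓕 ([s+1]-1≡s s)) (at 𝓕 ([s+1]-2≡s-1 s)) ⟩
      b + a                ≈⟨ solve 2 (λ a b → b :+ a := con 1 :* a :+ (con 1 :+ con 0) :* b) refl a b ⟩
      1# * a + (1# + 0#) * b ∎)
    where
    a = 𝓕 (s -ℤ + 1)
    b = 𝓕 s

  sumTo-cong : ∀ k {f g : ℕ → Carrier} → (∀ j → j ≤ k → f j ≈ g j) → sumTo R k f ≈ sumTo R k g
  sumTo-cong zero    f≈g = f≈g 0 z≤n
  sumTo-cong (suc k) f≈g =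
    +-cong (sumTo-cong k (λ j j≤k → f≈g j (ℕₚ.m≤n⇒m≤1+n j≤k))) (f≈g (suc k) ℕₚ.≤-refl)

  sumTo-telescope : ∀ k (t g : ℕ → Carrier) → (∀ j → j ≤ k → t j + g (suc j) ≈ g j) →
                    sumTo R k t + g (suc k) ≈ g 0
  sumTo-telescope zero    t g step = step 0 z≤n
  sumTo-telescope (suc k) t g step = begin
    (sumTo R k t + t (suc k)) + g (suc (suc k)) ≈⟨ +-assoc _ _ _ ⟩
    sumTo R k t + (t (suc k) + g (suc (suc k))) ≈⟨ +-congˡ (step (suc k) ℕₚ.≤-refl) ⟩
    sumTo R k t + g (suc k)                     ≈⟨ sumTo-telescope k t g (λ j j≤k → step j (ℕₚ.m≤n⇒m≤1+n j≤k)) ⟩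
    g 0                                         ∎

  x+[1-1]*y≈x : ∀ x y → x + (1# - 1#) * y ≈ x
  x+[1-1]*y≈x x y = begin
    x + (1# - 1#) * y ≈⟨ +-congˡ (*-congʳ (-‿inverseʳ 1#)) ⟩
    x + 0# * y        ≈⟨ +-congˡ (zeroˡ y) ⟩
    x + 0#            ≈⟨ +-identityʳ x ⟩
    x                 ∎

  alternating-sum-telescope :
    ∀ (a b : Carrier) (x : ℕ → Carrier) k →
    sumTo R k (λ j → pow R (- 1#) j * pow R a (k ∸ j) * pow R b j * (x j * a + x (suc j) * b))
      ≈ x 0 * pow R a (suc k) - pow R (- 1#) (suc k) * x (suc k) * pow R b (suc k)
  alternating-sum-telescope a b x k = x≈z//y _ _ _ (begin
    sumTo R k term + pow R (- 1#) (suc k) * x (suc k) * pow R b (suc k)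
      ≈⟨ +-congˡ last ⟩
    sumTo R k term + g (suc k)
      ≈⟨ sumTo-telescope k term g step ⟩
    g 0
      ≈⟨ solve 2 (λ x₀ A → con 1 :* A :* con 1 :* x₀ := x₀ :* A) refl (x 0) (pow R a (suc k)) ⟩
    x 0 * pow R a (suc k) ∎)
    where
    term g : ℕ → Carrier
    term j = pow R (- 1#) j * pow R a (k ∸ j) * pow R b j * (x j * a + x (suc j) * b)
    g j = pow R (- 1#) j * pow R a (suc k ∸ j) * pow R b j * x j

    last : pow R (- 1#) (suc k) * x (suc k) * pow R b (suc k) ≈ g (suc k)
    last = begin
      e * x (suc k) * B                   ≈⟨ solve 3 (λ e y B → e :* y :* B := e :* con 1 :* B :* y) refl e (x (suc k)) B ⟩
      e * 1# * B * x (suc k)              ≈⟨ *-congʳ (*-congʳ (*-congˡ (reflexive (cong (pow R a) (ℕₚ.n∸n≡0 k))))) ⟨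
      g (suc k)                           ∎
      where e = pow R (- 1#) (suc k); B = pow R b (suc k)

    step : ∀ j → j ≤ k → term j + g (suc j) ≈ g j
    step j j≤k = begin
      e * A * B * (x j * a + x (suc j) * b) + (- 1# * e) * A * (b * B) * x (suc j)
        ≈⟨ solve 8 (λ m e a b A B x₀ x₁ →
                      e :* A :* B :* (x₀ :* a :+ x₁ :* b) :+ (m :* e) :* A :* (b :* B) :* x₁
                      := e :* (a :* A) :* B :* x₀ :+ (con 1 :+ m) :* (e :* A :* B :* b :* x₁))
                   refl (- 1#) e a b A B (x j) (x (suc j)) ⟩
      e * (a * A) * B * x j + (1# - 1#) * (e * A * B * b * x (suc j))
        ≈⟨ x+[1-1]*y≈x _ _ ⟩
      e * (a * A) * B * x j
        ≈⟨ *-congʳ (*-congʳ (*-congˡ (reflexive (cong (pow R a) (ℕₚ.+-∸-assoc 1 j≤k))))) ⟨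
      g j ∎
      where e = pow R (- 1#) j; A = pow R a (k ∸ j); B = pow R b j

theorem5 : ∀ {c ℓ : Level} (R : CommutativeRing c ℓ) →
    let open CommutativeRing R in
    (𝓕 : ℤ → Carrier) → IsGenFib R 𝓕 →
    (r s : ℤ) (k : ℕ) →
    sumTo R k (λ j → pow R (- 1#) j * pow R (𝓕 (s -ℤ + 1)) (k ∸ j) * pow R (𝓕 s) j * 𝓕 (r +ℤ s +ℤ + j))
      ≈ fib R r * pow R (𝓕 (s -ℤ + 1)) (suc k) - pow R (- 1#) (suc k) * fib R (r +ℤ + suc k) * pow R (𝓕 s) (suc k)
theorem5 R 𝓕 isGenFib r s k = begin
  sumTo R k (λ j → pow R (- 1#) j * pow R a (k ∸ j) * pow R b j * 𝓕 (r +ℤ s +ℤ + j))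
    ≈⟨ sumTo-cong R k (λ j _ → *-congˡ (summand j)) ⟩
  sumTo R k (λ j → pow R (- 1#) j * pow R a (k ∸ j) * pow R b j * (x j * a + x (suc j) * b))
    ≈⟨ alternating-sum-telescope R a b x k ⟩
  x 0 * pow R a (suc k) - pow R (- 1#) (suc k) * x (suc k) * pow R b (suc k)
    ≈⟨ +-congʳ (*-congʳ (at R (fib R) (ℤₚ.+-identityʳ r))) ⟩
  fib R r * pow R a (suc k) - pow R (- 1#) (suc k) * x (suc k) * pow R b (suc k) ∎
  where
  open CommutativeRing R
  open import Relation.Binary.Reasoning.Setoid setoid
  a = 𝓕 (s -ℤ + 1)
  b = 𝓕 s

  x : ℕ → Carrier
  x j = fib R (r +ℤ + j)

  summand : ∀ j → 𝓕 (r +ℤ s +ℤ + j) ≈ x j * a + x (suc j) * b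
  summand j = begin
    𝓕 (r +ℤ s +ℤ + j)                         ≈⟨ at R 𝓕 (s+[r+j]≡r+s+j r s (+ j)) ⟨
    𝓕 (s +ℤ (r +ℤ + j))                       ≈⟨ genFib-addition R isGenFib s (r +ℤ + j) ⟩
    x j * a + fib R (ℤ.suc (r +ℤ + j)) * b    ≈⟨ +-congˡ (*-congʳ (at R (fib R) (1+[r+j]≡r+[1+j] r (+ j)))) ⟩
    x j * a + x (suc j) * b                   ∎
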